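{- For all integers $n\ge 3$ and $m\ge 2$, the metric dimension of the graph $(P_n\times P_m)\odot K_1$ equals $3$.
   Context: All graphs are finite, simple and connected. For vertices $u,v$, $d(u,v)$ is the length of a shortest $u$–$v$ path. For an ordered set $S=\{s_1,\dots,s_k\}$ of vertices of $G$, the metric representation of $v$ is $r(v|S)=(d(v,s_1),\dots,d(v,s_k))$; $S$ is a resolving set if $r(u|S)\ne r(v|S)$ for all distinct vertices $u,v$. The metric dimension $\dim(G)$ is the minimum cardinality of a resolving set. $P_n$ is the path on $n$ vertices, $K_1$ the single-vertex graph. The Cartesian product $G\times H$ has vertex set $V(G)\times V(H)$, with $(g,h)\sim(g',h')$ iff ($g=g'$ and $h\sim h'$) or ($g\sim g'$ and $h=h'$). The corona product $G\odot H$ (with $G$ of order $n$) is obtained from one copy of $G$ and $n$ copies of $H$ by joining every vertex of the $i$-th copy of $H$ to the $i$-th vertex of $G$; thus $G\odot K_1$ is $G$ with one pendant vertex attached to each vertex. -}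

module Defs where

open import Level using (0ℓ)
open import Data.Nat using (ℕ; zero; suc; _≤_)
open import Data.Fin using (Fin; toℕ)
open import Data.Unit using (⊤)
open import Data.Empty using (⊥)
open import Data.Sum using (_⊎_; inj₁; inj₂)
open import Data.Product using (_×_; _,_; Σ)
open import Relation.Binary.PropositionalEquality using (_≡_)

record Graph : Set₁ where
  field
    V   : Set
    Adj : V → V → Set
open Graph public

data Walk (G : Graph) : V G → V G → ℕ → Set where
  here : ∀ {u} → Walk G u u zero
  step : ∀ {u w v k} → Adj G u w → Walk G w v k → Walk G u v (suc k)

IsDist : (G : Graph) → V G → V G → ℕ → Set
IsDist G u v k = Walk G u v k × (∀ j → Walk G u v j → k ≤ j)

SameRep : (G : Graph) {k : ℕ} → (Fin k → V G) → V G → V G → Set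
SameRep G S u v = ∀ i d → (IsDist G u (S i) d → IsDist G v (S i) d)
                        × (IsDist G v (S i) d → IsDist G u (S i) d)

Resolving : (G : Graph) {k : ℕ} → (Fin k → V G) → Set
Resolving G S = ∀ u v → SameRep G S u v → u ≡ v

MetricDim : Graph → ℕ → Set
MetricDim G k = Σ (Fin k → V G) (λ S → Resolving G S)
              × (∀ j (S : Fin j → V G) → Resolving G S → k ≤ j)

P : ℕ → Graph
P n = record { V = Fin n ; Adj = λ i j → (toℕ j ≡ suc (toℕ i)) ⊎ (toℕ i ≡ suc (toℕ j)) }

K₁ : Graph
K₁ = record { V = ⊤ ; Adj = λ _ _ → ⊥ }

_□_ : Graph → Graph → Graph
G □ H = record
  { V = V G × V H
  ; Adj = λ { (g , h) (g' , h') → (g ≡ g' × Adj H h h') ⊎ (Adj G g g' × h ≡ h') } }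

-- Corona product G ⊙ H: base vertices inj₁ g, copy of H at g is inj₂ (g , h).
CAdj : (G H : Graph) → V G ⊎ (V G × V H) → V G ⊎ (V G × V H) → Set
CAdj G H (inj₁ a) (inj₁ b) = Adj G a b
CAdj G H (inj₁ a) (inj₂ (b , h)) = a ≡ b
CAdj G H (inj₂ (a , h)) (inj₁ b) = a ≡ b
CAdj G H (inj₂ (a , h)) (inj₂ (b , h')) = a ≡ b × Adj H h h'

_⊙_ : Graph → Graph → Graph
G ⊙ H = record { V = V G ⊎ (V G × V H) ; Adj = CAdj G H }

module Submission where

-- Rather than computing shortest walks directly, we describe a
-- distance by a *certificate*: a function d with d t t = 0, d u t = 0 only for
-- u = t, d changing by at most one along an edge, and every vertex at
-- distance k+1 from t having a neighbour at distance k.  Such a d is the graph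
-- distance.  Certificates exist for paths (|i - j|), are preserved by the
-- Cartesian product (sum of distances) and by attaching a pendant vertex to
-- every vertex (corona with K₁).  This gives the distance of the whole graph.
--
-- The base vertices at three corners (0,0), (0,M), (N,0) of the
-- grid resolve: from the three distances one recovers the layer (base/leaf)
-- and both grid coordinates by linear algebra.
--
-- For any two landmarks s₁, s₂ we exhibit two distinct vertices
-- at equal distances from both: either a leaf at x and a base vertex y one
-- step farther than x from both landmarks' anchors, or two base vertices
-- equidistant from both anchors.

open import Defs
open import Data.Nat using (ℕ; zero; suc; _≤_; _<_; _+_; _∸_; z≤n; s≤s; ∣_-_∣)
open import Data.Nat.Properties
open import Data.Nat.Tactic.RingSolver using (solve-∀)
open import Data.Fin using (Fin; toℕ; fromℕ; fromℕ<; inject₁) renaming (zero to fzero; suc to fsuc)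
open import Data.Fin.Properties using (toℕ-injective; toℕ<n; toℕ≤pred[n]; toℕ-fromℕ; toℕ-fromℕ<; toℕ-inject₁)
open import Data.Unit using (tt)
open import Data.Empty using (⊥-elim)
open import Data.Sum using (_⊎_; inj₁; inj₂)
open import Data.Product using (_×_; _,_; Σ; proj₁; proj₂)
open import Function using (_∘_)
open import Relation.Nullary using (¬_; yes; no)
open import Relation.Binary.PropositionalEquality
open import Relation.Binary.Definitions using (tri<; tri≈; tri>)

record DistanceCertificate (G : Graph) : Set where
  field
    dist      : V G → V G → ℕ
    dist-self : ∀ t → dist t t ≡ 0
    dist-zero : ∀ {u t} → dist u t ≡ 0 → u ≡ t
    dist-lip  : ∀ {u w} t → Adj G u w → dist u t ≤ suc (dist w t)
    dist-step : ∀ {u t k} → dist u t ≡ suc k → Σ (V G) λ w → Adj G u w × dist w t ≡ k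

module Certified {G : Graph} (D : DistanceCertificate G) where
  open DistanceCertificate D

  walk-bound : ∀ {u v k} t → Walk G u v k → dist u t ≤ k + dist v t
  walk-bound t here = ≤-refl
  walk-bound t (step adj walk) = ≤-trans (dist-lip t adj) (s≤s (walk-bound t walk))

  walk-of-length : ∀ {u t} k → dist u t ≡ k → Walk G u t k
  walk-of-length zero e with refl ← dist-zero e = here
  walk-of-length (suc k) e = let (w , adj , e′) = dist-step e in step adj (walk-of-length k e′)

  isDist : ∀ u t → IsDist G u t (dist u t)
  isDist u t = walk-of-length _ refl , λ j walk → begin
    dist u t      ≤⟨ walk-bound t walk ⟩
    j + dist t t  ≡⟨ cong (j +_) (dist-self t) ⟩
    j + 0         ≡⟨ +-identityʳ j ⟩
    j             ∎
    where open ≤-Reasoning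

  isDist⇒≡ : ∀ {u t k} → IsDist G u t k → k ≡ dist u t
  isDist⇒≡ {u} {t} (walk , minimal) = ≤-antisym (minimal _ (proj₁ (isDist u t))) (proj₂ (isDist u t) _ walk)

  sameRep⇒equal : ∀ {k} (S : Fin k → V G) {u v} → SameRep G S u v → ∀ i → dist u (S i) ≡ dist v (S i)
  sameRep⇒equal S {u} sr i = isDist⇒≡ (proj₁ (sr i _) (isDist u (S i)))

  equal⇒sameRep : ∀ {k} (S : Fin k → V G) {u v} → (∀ i → dist u (S i) ≡ dist v (S i)) → SameRep G S u v
  equal⇒sameRep S {u} {v} eqs i d =
    (λ p → subst (IsDist G v (S i)) (sym (trans (isDist⇒≡ p) (eqs i))) (isDist v (S i))) ,
    (λ p → subst (IsDist G u (S i)) (sym (trans (isDist⇒≡ p) (sym (eqs i)))) (isDist u (S i)))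

  Confusable : V G → V G → Set
  Confusable s₁ s₂ = Σ (V G) λ u → Σ (V G) λ v →
    ¬ u ≡ v × dist u s₁ ≡ dist v s₁ × dist u s₂ ≡ dist v s₂

  confusable⇒¬resolving : ∀ {s₁ s₂} → Confusable s₁ s₂ → ∀ {k} (S : Fin k → V G) →
                          (∀ i → S i ≡ s₁ ⊎ S i ≡ s₂) → ¬ Resolving G S
  confusable⇒¬resolving {s₁} {s₂} (u , v , u≢v , e₁ , e₂) S inPair resolving =
    u≢v (resolving u v (equal⇒sameRep S (agree ∘ inPair)))
    where
    agree : ∀ {s} → s ≡ s₁ ⊎ s ≡ s₂ → dist u s ≡ dist v s
    agree (inj₁ refl) = e₁
    agree (inj₂ refl) = e₂

  atLeastThree : V G → (∀ s₁ s₂ → Confusable s₁ s₂) → ∀ k (S : Fin k → V G) → Resolving G S → 3 ≤ k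
  atLeastThree g confuse 0 S res = ⊥-elim (confusable⇒¬resolving (confuse g g) S (λ ()) res)
  atLeastThree g confuse 1 S res =
    ⊥-elim (confusable⇒¬resolving (confuse (S fzero) (S fzero)) S (λ { fzero → inj₁ refl }) res)
  atLeastThree g confuse 2 S res =
    ⊥-elim (confusable⇒¬resolving (confuse (S fzero) (S (fsuc fzero))) S
              (λ { fzero → inj₁ refl ; (fsuc fzero) → inj₂ refl }) res)
  atLeastThree g confuse (suc (suc (suc k))) S res = s≤s (s≤s (s≤s z≤n))

∣n-1+n∣≡1 : ∀ n → ∣ n - suc n ∣ ≡ 1
∣n-1+n∣≡1 zero = refl
∣n-1+n∣≡1 (suc n) = ∣n-1+n∣≡1 n

∣1+t-a∣≡1+∣t-a∣ : ∀ {t a} → a ≤ t → ∣ suc t - a ∣ ≡ suc ∣ t - a ∣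
∣1+t-a∣≡1+∣t-a∣ {t} {zero} _ = cong suc (sym (∣-∣-identityʳ t))
∣1+t-a∣≡1+∣t-a∣ {suc t} {suc a} (s≤s a≤t) = ∣1+t-a∣≡1+∣t-a∣ a≤t

∣t-a∣≡1+∣1+t-a∣ : ∀ {t a} → suc t ≤ a → ∣ t - a ∣ ≡ suc ∣ suc t - a ∣
∣t-a∣≡1+∣1+t-a∣ {zero} {suc a} _ = refl
∣t-a∣≡1+∣1+t-a∣ {suc t} {suc a} (s≤s t<a) = ∣t-a∣≡1+∣1+t-a∣ t<a

path-adjacent : ∀ {k} {i j : Fin k} → Adj (P k) i j → ∣ toℕ i - toℕ j ∣ ≡ 1
path-adjacent {i = i} (inj₁ e) rewrite e = ∣n-1+n∣≡1 (toℕ i)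
path-adjacent {j = j} (inj₂ e) rewrite e = trans (∣-∣-comm (suc (toℕ j)) (toℕ j)) (∣n-1+n∣≡1 (toℕ j))

path-step-up : ∀ {k} {u t : Fin k} {d} → toℕ u < toℕ t → ∣ toℕ u - toℕ t ∣ ≡ suc d →
               Σ (Fin k) λ w → Adj (P k) u w × ∣ toℕ w - toℕ t ∣ ≡ d
path-step-up {u = u} {t} u<t e =
  fromℕ< u+1<k , inj₁ (toℕ-fromℕ< u+1<k) ,
  trans (cong (∣_- toℕ t ∣) (toℕ-fromℕ< u+1<k)) (suc-injective (trans (sym (∣t-a∣≡1+∣1+t-a∣ u<t)) e))
  where u+1<k = ≤-<-trans u<t (toℕ<n t)

path-step-down : ∀ {k} {u t : Fin k} {d} → toℕ t < toℕ u → ∣ toℕ u - toℕ t ∣ ≡ suc d →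
                 Σ (Fin k) λ w → Adj (P k) u w × ∣ toℕ w - toℕ t ∣ ≡ d
path-step-down {u = fsuc u} {t} (s≤s t≤u) e =
  inject₁ u , inj₂ (cong suc (sym (toℕ-inject₁ u))) ,
  trans (cong (∣_- toℕ t ∣) (toℕ-inject₁ u)) (suc-injective (trans (sym (∣1+t-a∣≡1+∣t-a∣ t≤u)) e))

pathCertificate : ∀ k → DistanceCertificate (P k)
pathCertificate k = record
  { dist      = λ i j → ∣ toℕ i - toℕ j ∣
  ; dist-self = λ i → ∣n-n∣≡0 (toℕ i)
  ; dist-zero = toℕ-injective ∘ ∣m-n∣≡0⇒m≡n
  ; dist-lip  = lip
  ; dist-step = stepToward
  }
  where
  lip : ∀ {u w} t → Adj (P k) u w → ∣ toℕ u - toℕ t ∣ ≤ suc ∣ toℕ w - toℕ t ∣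
  lip {u} {w} t adj = ≤-trans (∣-∣-triangle (toℕ u) (toℕ w) (toℕ t))
                              (≤-reflexive (cong (_+ ∣ toℕ w - toℕ t ∣) (path-adjacent adj)))

  stepToward : ∀ {u t d} → ∣ toℕ u - toℕ t ∣ ≡ suc d → Σ (Fin k) λ w → Adj (P k) u w × ∣ toℕ w - toℕ t ∣ ≡ d
  stepToward {u} {t} e with <-cmp (toℕ u) (toℕ t)
  ... | tri< u<t _ _ = path-step-up u<t e
  ... | tri≈ _ u≡t _ = ⊥-elim (0≢1+n (trans (sym (m≡n⇒∣m-n∣≡0 u≡t)) e))
  ... | tri> _ _ t<u = path-step-down t<u e

_⊗_ : ∀ {G H} → DistanceCertificate G → DistanceCertificate H → DistanceCertificate (G □ H)
_⊗_ {G} {H} DG DH = record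
  { dist      = λ { (g , h) (a , b) → dG g a + dH h b }
  ; dist-self = λ { (g , h) → cong₂ _+_ (selfG g) (selfH h) }
  ; dist-zero = λ { {g , h} {a , b} e → cong₂ _,_ (zeroG (m+n≡0⇒m≡0 _ e)) (zeroH (m+n≡0⇒n≡0 (dG g a) e)) }
  ; dist-lip  = lip
  ; dist-step = stepToward
  }
  where
  open DistanceCertificate DG renaming (dist to dG; dist-self to selfG; dist-zero to zeroG; dist-lip to lipG; dist-step to stepG)
  open DistanceCertificate DH renaming (dist to dH; dist-self to selfH; dist-zero to zeroH; dist-lip to lipH; dist-step to stepH)

  lip : ∀ {u w} t → Adj (G □ H) u w → dG (proj₁ u) (proj₁ t) + dH (proj₂ u) (proj₂ t)
                                      ≤ suc (dG (proj₁ w) (proj₁ t) + dH (proj₂ w) (proj₂ t))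
  lip {g , h} {.g , h′} (a , b) (inj₁ (refl , adj)) =
    ≤-trans (+-monoʳ-≤ (dG g a) (lipH b adj)) (≤-reflexive (+-suc (dG g a) (dH h′ b)))
  lip {g , h} {g′ , .h} (a , b) (inj₂ (adj , refl)) = +-monoˡ-≤ (dH h b) (lipG a adj)

  -- Step in the first factor while it is not yet aligned, then in the second.
  stepToward : ∀ {u t k} → dG (proj₁ u) (proj₁ t) + dH (proj₂ u) (proj₂ t) ≡ suc k →
               Σ (V (G □ H)) λ w → Adj (G □ H) u w × dG (proj₁ w) (proj₁ t) + dH (proj₂ w) (proj₂ t) ≡ k
  stepToward {g , h} {a , b} e with dG g a in eG
  ... | zero  = let (h′ , adj , e′) = stepH e in
                (g , h′) , inj₁ (refl , adj) , trans (cong (_+ dH h′ b) eG) e′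
  ... | suc j = let (g′ , adj , e′) = stepG eG in
                (g′ , h) , inj₂ (adj , refl) , trans (cong (_+ dH h b) e′) (suc-injective e)

-- Distance between the leaves at x and y, given the distance k of x and y:
-- a leaf reaches any other leaf through the two base vertices.
leafDist : ℕ → ℕ
leafDist zero    = zero
leafDist (suc k) = suc (suc (suc k))

leafDist≡0 : ∀ {k} → leafDist k ≡ 0 → k ≡ 0
leafDist≡0 {zero} _ = refl

n≤leafDist : ∀ k → k ≤ leafDist k
n≤leafDist zero    = z≤n
n≤leafDist (suc k) = s≤s (m≤n⇒m≤1+n (n≤1+n k))

leafDist≤2+n : ∀ k → leafDist k ≤ suc (suc k)
leafDist≤2+n zero    = z≤n
leafDist≤2+n (suc k) = ≤-refl

leafDist-pred : ∀ {k d} → leafDist d ≡ suc k → suc d ≡ k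
leafDist-pred {d = suc d} e = suc-injective e

leafDist-distinct : ∀ {k} → ¬ k ≡ 0 → leafDist k ≡ suc (suc k)
leafDist-distinct {zero} k≢0 = ⊥-elim (k≢0 refl)
leafDist-distinct {suc k} _ = refl

-- Attaching a pendant leaf to every vertex of G (the corona G ⊙ K₁): a leaf
-- is one step farther than its base vertex from every vertex except itself.
module Corona {G : Graph} (D : DistanceCertificate G) where
  open DistanceCertificate D renaming (dist to dG; dist-self to selfG; dist-zero to zeroG; dist-lip to lipG; dist-step to stepG)

  anchor : V (G ⊙ K₁) → V G
  anchor (inj₁ x)       = x
  anchor (inj₂ (x , _)) = x

  layer : V (G ⊙ K₁) → ℕ
  layer (inj₁ _) = 0
  layer (inj₂ _) = 1

  anchor-layer-injective : ∀ {u v : V (G ⊙ K₁)} → anchor u ≡ anchor v → layer u ≡ layer v → u ≡ v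
  anchor-layer-injective {u = inj₁ x}        {inj₁ .x}        refl _ = refl
  anchor-layer-injective {u = inj₂ (x , tt)} {inj₂ (.x , tt)} refl _ = refl


  coronaDist : V (G ⊙ K₁) → V (G ⊙ K₁) → ℕ
  coronaDist (inj₁ x)       (inj₁ y)       = dG x y
  coronaDist (inj₁ x)       (inj₂ (y , _)) = suc (dG x y)
  coronaDist (inj₂ (x , _)) (inj₁ y)       = suc (dG x y)
  coronaDist (inj₂ (x , _)) (inj₂ (y , _)) = leafDist (dG x y)

  private
    self : ∀ t → coronaDist t t ≡ 0
    self (inj₁ x)       = selfG x
    self (inj₂ (x , _)) = cong leafDist (selfG x)

    zero⇒equal : ∀ {u t} → coronaDist u t ≡ 0 → u ≡ t
    zero⇒equal {inj₁ x}        {inj₁ y}        e = cong inj₁ (zeroG e)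
    zero⇒equal {inj₂ (x , tt)} {inj₂ (y , tt)} e = cong (λ z → inj₂ (z , tt)) (zeroG (leafDist≡0 e))

    lip : ∀ {u w} t → Adj (G ⊙ K₁) u w → coronaDist u t ≤ suc (coronaDist w t)
    lip {inj₁ x}       {inj₁ x′}        (inj₁ y)       adj  = lipG y adj
    lip {inj₁ x}       {inj₁ x′}        (inj₂ (y , _)) adj  = s≤s (lipG y adj)
    lip {inj₁ x}       {inj₂ (.x , _)}  (inj₁ y)       refl = m≤n⇒m≤1+n (n≤1+n (dG x y))
    lip {inj₁ x}       {inj₂ (.x , _)}  (inj₂ (y , _)) refl = s≤s (n≤leafDist (dG x y))
    lip {inj₂ (x , _)} {inj₁ .x}        (inj₁ y)       refl = ≤-refl
    lip {inj₂ (x , _)} {inj₁ .x}        (inj₂ (y , _)) refl = leafDist≤2+n (dG x y)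
    lip {inj₂ (x , _)} {inj₂ (x′ , _)}  t              (_ , ())

    -- A leaf first steps to its base vertex; a base vertex walks in G and
    -- finally steps to the target leaf.
    stepToward : ∀ {u t k} → coronaDist u t ≡ suc k → Σ (V (G ⊙ K₁)) λ w → Adj (G ⊙ K₁) u w × coronaDist w t ≡ k
    stepToward {inj₁ x} {inj₁ y} e = let (w , adj , e′) = stepG e in inj₁ w , adj , e′
    stepToward {inj₁ x} {inj₂ (y , _)} {zero} e = inj₂ (x , tt) , refl , cong leafDist (suc-injective e)
    stepToward {inj₁ x} {inj₂ (y , _)} {suc k} e =
      let (w , adj , e′) = stepG (suc-injective e) in inj₁ w , adj , cong suc e′
    stepToward {inj₂ (x , _)} {inj₁ y} e = inj₁ x , refl , suc-injective e
    stepToward {inj₂ (x , _)} {inj₂ (y , _)} e = inj₁ x , refl , leafDist-pred e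

  corona : DistanceCertificate (G ⊙ K₁)
  corona = record
    { dist      = coronaDist
    ; dist-self = self
    ; dist-zero = zero⇒equal
    ; dist-lip  = λ {u} {w} → lip {u} {w}
    ; dist-step = λ {u} {t} → stepToward {u} {t}
    }

  -- Distance to a base vertex: climb down to the base graph, then walk in G.
  dist-to-base : ∀ u p → coronaDist u (inj₁ p) ≡ layer u + dG (anchor u) p
  dist-to-base (inj₁ x)       p = refl
  dist-to-base (inj₂ (x , _)) p = refl

  -- Two configurations in G that defeat a pair of landmarks anchored at p₁, p₂:
  -- a point x other than p₁, p₂ with a point y one step farther from both
  -- (its leaf is confused with y), or two points equidistant from both.
  LeafStep : V G → V G → Set
  LeafStep p₁ p₂ = Σ (V G) λ x → Σ (V G) λ y →
    ¬ x ≡ p₁ × ¬ x ≡ p₂ × dG y p₁ ≡ suc (dG x p₁) × dG y p₂ ≡ suc (dG x p₂)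

  Twins : V G → V G → Set
  Twins p₁ p₂ = Σ (V G) λ y → Σ (V G) λ y′ → ¬ y ≡ y′ × dG y p₁ ≡ dG y′ p₁ × dG y p₂ ≡ dG y′ p₂

  Defeating : V G → V G → Set
  Defeating p₁ p₂ = LeafStep p₁ p₂ ⊎ Twins p₁ p₂

  defeating-swap : ∀ {p₁ p₂} → Defeating p₁ p₂ → Defeating p₂ p₁
  defeating-swap (inj₁ (x , y , x≢p₁ , x≢p₂ , e₁ , e₂)) = inj₁ (x , y , x≢p₂ , x≢p₁ , e₂ , e₁)
  defeating-swap (inj₂ (y , y′ , y≢y′ , e₁ , e₂))       = inj₂ (y , y′ , y≢y′ , e₂ , e₁)

  open Certified corona using (Confusable)

  defeating⇒confusable : ∀ s₁ s₂ → Defeating (anchor s₁) (anchor s₂) → Confusable s₁ s₂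
  defeating⇒confusable s₁ s₂ (inj₁ (x , y , x≢p₁ , x≢p₂ , e₁ , e₂)) =
    inj₂ (x , tt) , inj₁ y , (λ ()) , leaf≈base s₁ x≢p₁ e₁ , leaf≈base s₂ x≢p₂ e₂
    where
    leaf≈base : ∀ {x y} s → ¬ x ≡ anchor s → dG y (anchor s) ≡ suc (dG x (anchor s)) →
                coronaDist (inj₂ (x , tt)) s ≡ coronaDist (inj₁ y) s
    leaf≈base (inj₁ p)       _   e = sym e
    leaf≈base (inj₂ (p , _)) x≢p e = trans (leafDist-distinct (x≢p ∘ zeroG)) (cong suc (sym e))
  defeating⇒confusable s₁ s₂ (inj₂ (y , y′ , y≢y′ , e₁ , e₂)) =
    inj₁ y , inj₁ y′ , (λ { refl → y≢y′ refl }) , base≈base s₁ e₁ , base≈base s₂ e₂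
    where
    base≈base : ∀ s → dG y (anchor s) ≡ dG y′ (anchor s) → coronaDist (inj₁ y) s ≡ coronaDist (inj₁ y′) s
    base≈base (inj₁ p) e = e
    base≈base (inj₂ _) e = cong suc e

double-injective : ∀ {a b} → a + a ≡ b + b → a ≡ b
double-injective {zero}  {zero}  _ = refl
double-injective {suc a} {suc b} e =
  cong suc (double-injective (suc-injective (trans (sym (+-suc a a)) (trans (suc-injective e) (+-suc b b)))))

regroup-BC : ∀ e i j a b → (e + (i + b)) + (e + (a + j)) ≡ (e + e) + ((i + a) + (j + b))
regroup-BC = solve-∀

regroup-AB : ∀ e i j b → (e + (i + j)) + (e + (i + b)) ≡ ((e + i) + (e + i)) + (j + b)
regroup-AB = solve-∀

-- The layer e and coordinates i ≤ N, j ≤ M are recovered from the distances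
-- e + (i + j), e + (i + (M ∸ j)), e + ((N ∸ i) + j) to three corners.
corner-sums-injective : ∀ {N M e i j e′ i′ j′} → i ≤ N → j ≤ M → i′ ≤ N → j′ ≤ M →
  e + (i + j) ≡ e′ + (i′ + j′) →
  e + (i + (M ∸ j)) ≡ e′ + (i′ + (M ∸ j′)) →
  e + ((N ∸ i) + j) ≡ e′ + ((N ∸ i′) + j′) →
  e ≡ e′ × i ≡ i′ × j ≡ j′
corner-sums-injective {N} {M} {e} {i} {j} {e′} {i′} {j′} i≤N j≤M i′≤N j′≤M hA hB hC = e≡e′ , i≡i′ , j≡j′
  where
  sumBC : ∀ e i j → i ≤ N → j ≤ M → (e + (i + (M ∸ j))) + (e + ((N ∸ i) + j)) ≡ (e + e) + (N + M)
  sumBC e i j i≤N j≤M =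
    trans (regroup-BC e i j (N ∸ i) (M ∸ j)) (cong₂ (λ a b → (e + e) + (a + b)) (m+[n∸m]≡n i≤N) (m+[n∸m]≡n j≤M))

  sumAB : ∀ e i j → j ≤ M → (e + (i + j)) + (e + (i + (M ∸ j))) ≡ ((e + i) + (e + i)) + M
  sumAB e i j j≤M = trans (regroup-AB e i j (M ∸ j)) (cong (((e + i) + (e + i)) +_) (m+[n∸m]≡n j≤M))

  e≡e′ : e ≡ e′
  e≡e′ = double-injective (+-cancelʳ-≡ (N + M) _ _
           (trans (sym (sumBC e i j i≤N j≤M)) (trans (cong₂ _+_ hB hC) (sumBC e′ i′ j′ i′≤N j′≤M))))

  e+i≡e′+i′ : e + i ≡ e′ + i′
  e+i≡e′+i′ = double-injective (+-cancelʳ-≡ M _ _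
           (trans (sym (sumAB e i j j≤M)) (trans (cong₂ _+_ hA hB) (sumAB e′ i′ j′ j′≤M))))

  i≡i′ : i ≡ i′
  i≡i′ = +-cancelˡ-≡ e′ i i′ (trans (cong (_+ i) (sym e≡e′)) e+i≡e′+i′)

  j≡j′ : j ≡ j′
  j≡j′ = +-cancelˡ-≡ (e′ + i′) j j′ (begin
    (e′ + i′) + j  ≡⟨ cong (_+ j) (sym e+i≡e′+i′) ⟩
    (e + i) + j    ≡⟨ +-assoc e i j ⟩
    e + (i + j)    ≡⟨ hA ⟩
    e′ + (i′ + j′) ≡⟨ +-assoc e′ i′ j′ ⟨
    (e′ + i′) + j′ ∎)
    where open ≡-Reasoning

gridCertificate : ∀ n m → DistanceCertificate (P n □ P m)
gridCertificate n m = pathCertificate n ⊗ pathCertificate m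

∣x-K∣≡K∸x : ∀ {K x} → x ≤ K → ∣ x - toℕ (fromℕ K) ∣ ≡ K ∸ x
∣x-K∣≡K∸x {K} {x} x≤K = trans (cong (∣ x -_∣) (toℕ-fromℕ K)) (m≤n⇒∣m-n∣≡n∸m x≤K)

module Corners (N M : ℕ) where
  open Corona (gridCertificate (suc N) (suc M))

  corners : Fin 3 → V ((P (suc N) □ P (suc M)) ⊙ K₁)
  corners fzero               = inj₁ (fzero , fzero)
  corners (fsuc fzero)        = inj₁ (fzero , fromℕ M)
  corners (fsuc (fsuc fzero)) = inj₁ (fromℕ N , fzero)

  row col : V ((P (suc N) □ P (suc M)) ⊙ K₁) → ℕ
  row u = toℕ (proj₁ (anchor u))
  col u = toℕ (proj₂ (anchor u))

  to-origin : ∀ u → coronaDist u (corners fzero) ≡ layer u + (row u + col u)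
  to-origin u = trans (dist-to-base u _)
    (cong (layer u +_) (cong₂ _+_ (∣-∣-identityʳ (row u)) (∣-∣-identityʳ (col u))))

  to-last-column : ∀ u → coronaDist u (corners (fsuc fzero)) ≡ layer u + (row u + (M ∸ col u))
  to-last-column u = trans (dist-to-base u _)
    (cong (layer u +_) (cong₂ _+_ (∣-∣-identityʳ (row u)) (∣x-K∣≡K∸x (toℕ≤pred[n] (proj₂ (anchor u))))))

  to-last-row : ∀ u → coronaDist u (corners (fsuc (fsuc fzero))) ≡ layer u + ((N ∸ row u) + col u)
  to-last-row u = trans (dist-to-base u _)
    (cong (layer u +_) (cong₂ _+_ (∣x-K∣≡K∸x (toℕ≤pred[n] (proj₁ (anchor u)))) (∣-∣-identityʳ (col u))))

  cornersResolve : Resolving ((P (suc N) □ P (suc M)) ⊙ K₁) corners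
  cornersResolve u v sameRep =
    let (layer≡ , row≡ , col≡) = recovered in
    anchor-layer-injective (cong₂ _,_ (toℕ-injective row≡) (toℕ-injective col≡)) layer≡
    where
    open Certified corona using (sameRep⇒equal)

    via : ∀ {f : V ((P (suc N) □ P (suc M)) ⊙ K₁) → ℕ} i → (∀ w → coronaDist w (corners i) ≡ f w) → f u ≡ f v
    via i formula = trans (sym (formula u)) (trans (sameRep⇒equal corners sameRep i) (formula v))

    recovered : layer u ≡ layer v × row u ≡ row v × col u ≡ col v
    recovered = corner-sums-injective
      (toℕ≤pred[n] (proj₁ (anchor u))) (toℕ≤pred[n] (proj₂ (anchor u)))
      (toℕ≤pred[n] (proj₁ (anchor v))) (toℕ≤pred[n] (proj₂ (anchor v)))
      (via fzero to-origin) (via (fsuc fzero) to-last-column) (via (fsuc (fsuc fzero)) to-last-row)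

path-neighbour : ∀ {k} (c : Fin (suc (suc k))) → Σ (Fin (suc (suc k))) (Adj (P (suc (suc k))) c)
path-neighbour fzero    = fsuc fzero , inj₁ refl
path-neighbour (fsuc c) = inject₁ c , inj₂ (cong suc (sym (toℕ-inject₁ c)))

otherThan : ∀ {k} (c : Fin (suc (suc k))) → Σ (Fin (suc (suc k))) λ c′ → ¬ c′ ≡ c
otherThan fzero    = fsuc fzero , λ ()
otherThan (fsuc _) = fzero , λ ()

module TwoLandmarksFail (n′ m′ : ℕ) where
  N M : ℕ
  N = suc (suc n′)
  M = suc m′

  Point : Set
  Point = Fin (suc N) × Fin (suc M)

  open DistanceCertificate (gridCertificate (suc N) (suc M)) using (dist)
  open DistanceCertificate (pathCertificate (suc M)) using () renaming (dist-step to columnStep)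
  open Corona (gridCertificate (suc N) (suc M))
  open Certified corona using (Confusable)

  row : Point → ℕ
  row p = toℕ (proj₁ p)

  differentRow : ∀ {x p : Point} → ¬ row x ≡ row p → ¬ x ≡ p
  differentRow r≢ refl = r≢ refl

  differentColumn : ∀ {x p : Point} → ¬ proj₂ x ≡ proj₂ p → ¬ x ≡ p
  differentColumn c≢ refl = c≢ refl

  1≢N : ¬ 1 ≡ N
  1≢N e = 0≢1+n (suc-injective e)

  rowMove : ∀ r r′ c (p : Point) → ∣ toℕ r′ - row p ∣ ≡ suc ∣ toℕ r - row p ∣ →
            dist (r′ , c) p ≡ suc (dist (r , c) p)
  rowMove r r′ c (a , b) e = cong (_+ ∣ toℕ c - toℕ b ∣) e

  columnMove : ∀ c c′ r (p : Point) → ∣ toℕ c′ - toℕ (proj₂ p) ∣ ≡ suc ∣ toℕ c - toℕ (proj₂ p) ∣ →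
               dist (r , c′) p ≡ suc (dist (r , c) p)
  columnMove c c′ r (a , b) e = trans (cong (∣ toℕ r - toℕ a ∣ +_) e) (+-suc _ _)

  lastRow secondLastRow thirdLastRow : Fin (suc N)
  lastRow       = fromℕ N
  secondLastRow = inject₁ (fromℕ (suc n′))
  thirdLastRow  = inject₁ (inject₁ (fromℕ n′))

  toℕ-secondLastRow : toℕ secondLastRow ≡ suc n′
  toℕ-secondLastRow = trans (toℕ-inject₁ _) (toℕ-fromℕ (suc n′))

  toℕ-thirdLastRow : toℕ thirdLastRow ≡ n′
  toℕ-thirdLastRow = trans (toℕ-inject₁ _) (trans (toℕ-inject₁ _) (toℕ-fromℕ n′))

  -- Both anchors above the last row, p₁ off row N-1: the leaf at (N-1, c) and
  -- the base vertex (N, c) below it, with c off the column of p₂.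
  lastRowStep : ∀ p₁ p₂ → row p₁ ≤ suc n′ → row p₂ ≤ suc n′ → ¬ row p₁ ≡ suc n′ → LeafStep p₁ p₂
  lastRowStep p₁ p₂ r₁≤ r₂≤ r₁≢ =
    let (c , c≢c₂) = otherThan (proj₂ p₂) in
    (secondLastRow , c) , (lastRow , c) ,
    differentRow (λ e → r₁≢ (trans (sym e) toℕ-secondLastRow)) , differentColumn c≢c₂ ,
    rowMove secondLastRow lastRow c p₁ (downward r₁≤) , rowMove secondLastRow lastRow c p₂ (downward r₂≤)
    where
    downward : ∀ {a} → a ≤ suc n′ → ∣ toℕ lastRow - a ∣ ≡ suc ∣ toℕ secondLastRow - a ∣
    downward {a} a≤ = subst₂ (λ r r′ → ∣ r′ - a ∣ ≡ suc ∣ r - a ∣)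
                        (sym toℕ-secondLastRow) (sym (toℕ-fromℕ N)) (∣1+t-a∣≡1+∣t-a∣ a≤)

  -- p₁ below the first row, p₂ in the last row: the leaf at (1, c) and the base
  -- vertex (0, c) above it, with c off the column of p₁.
  firstRowStep : ∀ p₁ p₂ → 1 ≤ row p₁ → row p₂ ≡ N → LeafStep p₁ p₂
  firstRowStep p₁ p₂ 1≤r₁ r₂≡N =
    let (c , c≢c₁) = otherThan (proj₂ p₁) in
    (fsuc fzero , c) , (fzero , c) ,
    differentColumn c≢c₁ , differentRow (λ e → 1≢N (trans e r₂≡N)) ,
    rowMove (fsuc fzero) fzero c p₁ (∣t-a∣≡1+∣1+t-a∣ 1≤r₁) ,
    rowMove (fsuc fzero) fzero c p₂ (∣t-a∣≡1+∣1+t-a∣ (subst (1 ≤_) (sym r₂≡N) (s≤s z≤n)))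

  -- Both anchors in row N-1: rows N-2 and N are mirror images of each other.
  middleTwins : ∀ p₁ p₂ → row p₁ ≡ suc n′ → row p₂ ≡ suc n′ → Twins p₁ p₂
  middleTwins p₁ p₂ r₁≡ r₂≡ =
    (thirdLastRow , fzero) , (lastRow , fzero) ,
    differentRow (λ e → <⇒≢ (m<n⇒m<1+n (n<1+n n′)) (trans (sym toℕ-thirdLastRow) (trans e (toℕ-fromℕ N)))) ,
    mirror p₁ r₁≡ , mirror p₂ r₂≡
    where
    mirror : ∀ p → row p ≡ suc n′ → dist (thirdLastRow , fzero) p ≡ dist (lastRow , fzero) p
    mirror (a , b) e rewrite toℕ-thirdLastRow | toℕ-fromℕ N | e =
      cong (_+ ∣ 0 - toℕ b ∣) (sym (∣-∣-comm (suc n′) n′))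

  -- Anchors in the first and last row, same column: the leaf at (1, c) and
  -- the base vertex beside it.
  sameColumnStep : ∀ a₁ a₂ c → toℕ a₁ ≡ 0 → toℕ a₂ ≡ N → LeafStep (a₁ , c) (a₂ , c)
  sameColumnStep a₁ a₂ c r₁≡0 r₂≡N =
    let (c′ , adj) = path-neighbour c in
    (fsuc fzero , c) , (fsuc fzero , c′) ,
    differentRow (λ e → 1+n≢0 (trans e r₁≡0)) , differentRow (λ e → 1≢N (trans e r₂≡N)) ,
    columnMove c c′ (fsuc fzero) (a₁ , c) (sideways adj) , columnMove c c′ (fsuc fzero) (a₂ , c) (sideways adj)
    where
    sideways : ∀ {c′} → Adj (P (suc M)) c c′ → ∣ toℕ c′ - toℕ c ∣ ≡ suc ∣ toℕ c - toℕ c ∣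
    sideways {c′} adj = trans (∣-∣-comm (toℕ c′) (toℕ c)) (trans (path-adjacent {i = c} {c′} adj) (cong suc (sym (∣n-n∣≡0 (toℕ c)))))

  -- Anchors in the first and last row, different columns: (0, c₂) and the
  -- vertex (1, c′) with c′ the neighbour of c₂ towards c₁.
  acrossTwins : ∀ {a₁ a₂ c₁ c₂ c′ k} → toℕ a₁ ≡ 0 → toℕ a₂ ≡ N → Adj (P (suc M)) c₂ c′ →
                ∣ toℕ c₂ - toℕ c₁ ∣ ≡ suc k → ∣ toℕ c′ - toℕ c₁ ∣ ≡ k → Twins (a₁ , c₁) (a₂ , c₂)
  acrossTwins {a₁} {a₂} {c₁} {c₂} {c′} {k} r₁≡0 r₂≡N adj gap gap′ =
    (fzero , c₂) , (fsuc fzero , c′) , differentRow (λ ()) ,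
    trans (cong₂ _+_ (cong (∣ 0 -_∣) r₁≡0) gap) (sym (cong₂ _+_ (cong (∣ 1 -_∣) r₁≡0) gap′)) ,
    (begin
      ∣ 0 - toℕ a₂ ∣ + ∣ toℕ c₂ - toℕ c₂ ∣ ≡⟨ cong₂ _+_ (cong (∣ 0 -_∣) r₂≡N) (∣n-n∣≡0 (toℕ c₂)) ⟩
      N + 0                               ≡⟨ +-identityʳ N ⟩
      1 + suc n′                          ≡⟨ +-comm (suc n′) 1 ⟨
      suc n′ + 1                          ≡⟨ cong₂ _+_ (cong (∣ 1 -_∣) r₂≡N) (trans (∣-∣-comm (toℕ c′) (toℕ c₂)) (path-adjacent {i = c₂} {c′} adj)) ⟨
      ∣ 1 - toℕ a₂ ∣ + ∣ toℕ c′ - toℕ c₂ ∣ ∎)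
    where open ≡-Reasoning

  acrossGrid : ∀ p₁ p₂ → row p₁ ≡ 0 → row p₂ ≡ N → Defeating p₁ p₂
  acrossGrid (a₁ , c₁) (a₂ , c₂) r₁≡0 r₂≡N with ∣ toℕ c₂ - toℕ c₁ ∣ in gap
  ... | zero with refl ← toℕ-injective {i = c₂} {c₁} (∣m-n∣≡0⇒m≡n gap) = inj₁ (sameColumnStep a₁ a₂ c₂ r₁≡0 r₂≡N)
  ... | suc k = let (c′ , adj , gap′) = columnStep gap in inj₂ (acrossTwins r₁≡0 r₂≡N adj gap gap′)

  beyondSecondLast⇒last : ∀ p → ¬ row p ≤ suc n′ → row p ≡ N
  beyondSecondLast⇒last p r≰ = ≤-antisym (toℕ≤pred[n] (proj₁ p)) (≰⇒> r≰)

  defeating-ordered : ∀ p₁ p₂ → row p₁ ≤ row p₂ → Defeating p₁ p₂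
  defeating-ordered p₁ p₂ r₁≤r₂ with row p₂ ≤? suc n′
  ... | yes r₂≤ with row p₁ ≟ suc n′
  ...   | no  r₁≢ = inj₁ (lastRowStep p₁ p₂ (≤-trans r₁≤r₂ r₂≤) r₂≤ r₁≢)
  ...   | yes r₁≡ = inj₂ (middleTwins p₁ p₂ r₁≡ (≤-antisym r₂≤ (subst (_≤ row p₂) r₁≡ r₁≤r₂)))
  defeating-ordered p₁ p₂ r₁≤r₂ | no r₂≰ with row p₁ ≟ 0
  ...   | yes r₁≡0 = acrossGrid p₁ p₂ r₁≡0 (beyondSecondLast⇒last p₂ r₂≰)
  ...   | no  r₁≢0 = inj₁ (firstRowStep p₁ p₂ (n≢0⇒n>0 r₁≢0) (beyondSecondLast⇒last p₂ r₂≰))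

  defeating : ∀ p₁ p₂ → Defeating p₁ p₂
  defeating p₁ p₂ with ≤-total (row p₁) (row p₂)
  ... | inj₁ r₁≤r₂ = defeating-ordered p₁ p₂ r₁≤r₂
  ... | inj₂ r₂≤r₁ = defeating-swap (defeating-ordered p₂ p₁ r₂≤r₁)

  confusable : ∀ s₁ s₂ → Confusable s₁ s₂
  confusable s₁ s₂ = defeating⇒confusable s₁ s₂ (defeating (anchor s₁) (anchor s₂))

mainTheorem1 : (n m : ℕ) → 3 ≤ n → 2 ≤ m → MetricDim ((P n □ P m) ⊙ K₁) 3
mainTheorem1 (suc (suc (suc n′))) (suc (suc m′)) (s≤s (s≤s (s≤s _))) (s≤s (s≤s _)) =
  (corners , cornersResolve) ,
  atLeastThree (inj₁ (fzero , fzero)) confusable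
  where
  open Corners (suc (suc n′)) (suc m′) using (corners; cornersResolve)
  open TwoLandmarksFail n′ m′ using (confusable)
  open Certified (Corona.corona (gridCertificate (suc (suc (suc n′))) (suc (suc m′)))) using (atLeastThree)
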